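{- Let $\mathcal J$ be an interpretation of the index symbols. Then: (1) the subtyping relation $\sqsubseteq_{\mathcal J}$ on sized types is reflexive, transitive and closed under index substitutions (if $\sigma_1\sqsubseteq_{\mathcal J}\sigma_2$ then $\sigma_1\vartheta\sqsubseteq_{\mathcal J}\sigma_2\vartheta$ for every index substitution $\vartheta$); (2) if $a\le_{\mathcal J} b$ then $\sigma\{i\mapsto a\}\sqsubseteq_{\mathcal J}\sigma\{i\mapsto b\}$ for every sized type $\sigma$ and every index variable $i\notin\mathrm{FNV}(\sigma)$.
   Context: Index terms. Let $\mathcal I$ be a set of index symbols with arities containing $0$, unary $\mathsf s$ and binary $+$. Index terms: $a ::= i \mid g(a_1,\dots,a_{\mathrm{ar}(g)})$ with $i$ index variables, $g\in\mathcal I$; $\mathrm{Var}(a)$ is the set of index variables of $a$; index substitutions map index variables to index terms. An interpretation $\mathcal J$ maps each $k$-ary $g$ to a total weakly monotone function $\mathbb N^k\to\mathbb N$, with $0,\mathsf s,+$ interpreted as zero, successor, addition; $[\![a]\!]^\rho_{\mathcal J}$ is the value of $a$ under an assignment $\rho$ of naturals to index variables, and $a\le_{\mathcal J} b$ means $[\![a]\!]^\rho_{\mathcal J}\le[\![b]\!]^\rho_{\mathcal J}$ for all $\rho$. Sized types. Over a fixed finite set of base types $B$: monotypes $\tau ::= B^{a} \mid \tau_1\times\tau_2 \mid \sigma\to\tau$; polytypes $\forall\bar i.\,\sigma\to\tau$ (the sequence $\bar i$ of index variables is bound); types $\sigma ::= \tau \mid$ polytype. A monotype $\tau$ is identified with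 $\forall\epsilon.\tau$, so every type has the form $\forall\bar i.\tau$. Types are taken up to $\alpha$-equivalence and index substitutions act capture-avoidingly. Free index variables in positive/negative positions: $\mathrm{FPV}(B^a)=\mathrm{Var}(a)$, $\mathrm{FNV}(B^a)=\emptyset$; for $\tau_1\times\tau_2$ both are unions over the components; $\mathrm{FPV}(\sigma\to\tau)=\mathrm{FNV}(\sigma)\cup\mathrm{FPV}(\tau)$, $\mathrm{FNV}(\sigma\to\tau)=\mathrm{FPV}(\sigma)\cup\mathrm{FNV}(\tau)$; $\mathrm{FPV}(\forall\bar i.\tau)=\mathrm{FPV}(\tau)\setminus\{\bar i\}$, likewise for FNV; $\mathrm{FV}=\mathrm{FPV}\cup\mathrm{FNV}$. Instantiation: $\forall\bar i.\tau\sqsupseteq\tau\{\bar i\mapsto\bar a\}$ for any index terms $\bar a$ (so $\tau\sqsupseteq\tau$). Subtyping $\sqsubseteq_{\mathcal J}$ is inductively defined by: $B^{a}\sqsubseteq_{\mathcal J}B^{b}$ if $a\le_{\mathcal J}b$; $\tau_1\times\tau_2\sqsubseteq_{\mathcal J}\tau_3\times\tau_4$ if $\tau_1\sqsubseteq_{\mathcal J}\tau_3$ and $\tau_2\sqsubseteq_{\mathcal J}\tau_4$; $\sigma_1\to\tau_1\sqsubseteq_{\mathcal J}\sigma_2\to\tau_2$ if $\sigma_2\sqsubseteq_{\mathcal J}\sigma_1$ and $\tau_1\sqsubseteq_{\mathcal J}\tau_2$; $\forall\bar i.\tau_1\sqsubseteq_{\mathcal J}\sigma_2$ if $\sigma_2\sqsupseteq\tau_2$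 for some monotype $\tau_2$ with $\tau_1\sqsubseteq_{\mathcal J}\tau_2$ and no variable of $\bar i$ belongs to $\mathrm{FV}(\sigma_2)$. -}

module Defs where

open import Data.Nat using (ℕ; zero; suc; _+_; _≤_)
open import Data.Nat.Properties using (_≟_)
open import Data.Fin using (Fin)
open import Data.Vec using (Vec; []; _∷_; lookup)
open import Data.Sum using (_⊎_)
open import Data.Empty using (⊥)
open import Relation.Nullary using (yes; no)

-- Sized types over:
--   Sym : the index symbols OTHER than 0, s, + (these three are built in),
--   ar  : their arities,
--   nB  : the number of base types (base types are Fin nB).
-- Index variables are de Bruijn indices (ℕ); binders of polytypes are
-- nameless, so α-equivalence is syntactic equality and substitution is
-- capture-avoiding by construction.
module Sized (Sym : Set) (ar : Sym → ℕ) (nB : ℕ) where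

  data Term : Set where
    var  : ℕ → Term
    0ᵢ   : Term
    sᵢ   : Term → Term
    _+ᵢ_ : Term → Term → Term
    app  : (g : Sym) → Vec Term (ar g) → Term

  data _∈V_ (x : ℕ) : Term → Set where
    here  : x ∈V var x
    ins   : ∀ {a} → x ∈V a → x ∈V sᵢ a
    in+ˡ  : ∀ {a b} → x ∈V a → x ∈V (a +ᵢ b)
    in+ʳ  : ∀ {a b} → x ∈V b → x ∈V (a +ᵢ b)
    inapp : ∀ {g as} (k : Fin (ar g)) → x ∈V lookup as k → x ∈V app g as

  mutual
    ren : (ℕ → ℕ) → Term → Term
    ren r (var x) = var (r x)
    ren r 0ᵢ = 0ᵢ
    ren r (sᵢ a) = sᵢ (ren r a)
    ren r (a +ᵢ b) = ren r a +ᵢ ren r b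
    ren r (app g as) = app g (renV r as)

    renV : ∀ {n} → (ℕ → ℕ) → Vec Term n → Vec Term n
    renV r [] = []
    renV r (a ∷ as) = ren r a ∷ renV r as

  Subst : Set
  Subst = ℕ → Term

  mutual
    sub : Subst → Term → Term
    sub θ (var x) = θ x
    sub θ 0ᵢ = 0ᵢ
    sub θ (sᵢ a) = sᵢ (sub θ a)
    sub θ (a +ᵢ b) = sub θ a +ᵢ sub θ b
    sub θ (app g as) = app g (subV θ as)

    subV : ∀ {n} → Subst → Vec Term n → Vec Term n
    subV θ [] = []
    subV θ (a ∷ as) = sub θ a ∷ subV θ as

  lift : Subst → Subst
  lift θ zero = var zero
  lift θ (suc x) = ren suc (θ x)

  liftN : ℕ → Subst → Subst
  liftN zero θ = θ
  liftN (suc n) θ = lift (liftN n θ)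

  pt : ℕ → Term → Subst
  pt i a x with x ≟ i
  ... | yes _ = a
  ... | no  _ = var x

  -- Monotypes and types.  poly n σ τ is the polytype ∀ i₀…iₙ. σ → τ
  -- (n+1 ≥ 1 bound variables, de Bruijn indices 0..n in σ and τ);
  -- a monotype τ is the type mono τ (= ∀ε.τ).
  mutual
    data Mono : Set where
      base : Fin nB → Term → Mono
      _⊗_  : Mono → Mono → Mono
      _⇒_  : Ty → Mono → Mono

    data Ty : Set where
      mono : Mono → Ty
      poly : (n : ℕ) → Ty → Mono → Ty

  binders : Ty → ℕ
  binders (mono τ) = zero
  binders (poly n σ τ) = suc n

  body : Ty → Mono
  body (mono τ) = τ
  body (poly n σ τ) = σ ⇒ τ

  mutual
    subM : Subst → Mono → Mono
    subM θ (base β a) = base β (sub θ a)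
    subM θ (τ₁ ⊗ τ₂) = subM θ τ₁ ⊗ subM θ τ₂
    subM θ (σ ⇒ τ) = subT θ σ ⇒ subM θ τ

    subT : Subst → Ty → Ty
    subT θ (mono τ) = mono (subM θ τ)
    subT θ (poly n σ τ) = poly n (subT (liftN (suc n) θ) σ) (subM (liftN (suc n) θ) τ)

  mutual
    FPVm : ℕ → Mono → Set
    FPVm x (base β a) = x ∈V a
    FPVm x (τ₁ ⊗ τ₂) = FPVm x τ₁ ⊎ FPVm x τ₂
    FPVm x (σ ⇒ τ) = FNVt x σ ⊎ FPVm x τ

    FNVm : ℕ → Mono → Set
    FNVm x (base β a) = ⊥
    FNVm x (τ₁ ⊗ τ₂) = FNVm x τ₁ ⊎ FNVm x τ₂
    FNVm x (σ ⇒ τ) = FPVt x σ ⊎ FNVm x τ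

    FPVt : ℕ → Ty → Set
    FPVt x (mono τ) = FPVm x τ
    FPVt x (poly n σ τ) = FNVt (suc n + x) σ ⊎ FPVm (suc n + x) τ

    FNVt : ℕ → Ty → Set
    FNVt x (mono τ) = FNVm x τ
    FNVt x (poly n σ τ) = FPVt (suc n + x) σ ⊎ FNVm (suc n + x) τ

  instSub : ∀ {m} → Vec Term m → Subst → Subst
  instSub [] rest x = rest x
  instSub (b ∷ bs) rest zero = b
  instSub (b ∷ bs) rest (suc x) = instSub bs rest x

  -- Instantiation σ ⊒ (body σ){ī ↦ b̄}, computed in a scope in which k fresh
  -- index variables (de Bruijn 0..k-1) have been added in front of the
  -- scope of σ.  With k = 0 this is exactly the instantiation relation.
  instAt : (k : ℕ) (σ : Ty) → Vec Term (binders σ) → Mono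
  instAt k σ bs = subM (instSub bs (λ y → var (k + y))) (body σ)

  record Interp : Set where
    field
      ⟦_⟧ˢ : (g : Sym) → Vec ℕ (ar g) → ℕ
      monotone : ∀ g (xs ys : Vec ℕ (ar g)) →
                 (∀ k → lookup xs k ≤ lookup ys k) → ⟦ g ⟧ˢ xs ≤ ⟦ g ⟧ˢ ys

  module Sub (J : Interp) where
    open Interp J

    mutual
      ⟦_⟧ : Term → (ℕ → ℕ) → ℕ
      ⟦ var x ⟧ ρ = ρ x
      ⟦ 0ᵢ ⟧ ρ = zero
      ⟦ sᵢ a ⟧ ρ = suc (⟦ a ⟧ ρ)
      ⟦ a +ᵢ b ⟧ ρ = ⟦ a ⟧ ρ + ⟦ b ⟧ ρ
      ⟦ app g as ⟧ ρ = ⟦ g ⟧ˢ (⟦ as ⟧V ρ)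

      ⟦_⟧V : ∀ {n} → Vec Term n → (ℕ → ℕ) → Vec ℕ n
      ⟦ [] ⟧V ρ = []
      ⟦ a ∷ as ⟧V ρ = ⟦ a ⟧ ρ ∷ ⟦ as ⟧V ρ

    _≤J_ : Term → Term → Set
    a ≤J b = ∀ ρ → ⟦ a ⟧ ρ ≤ ⟦ b ⟧ ρ

    data _⊑_ : Ty → Ty → Set where
      ⊑base : ∀ {β a b} → a ≤J b → mono (base β a) ⊑ mono (base β b)
      ⊑prod : ∀ {τ₁ τ₂ τ₃ τ₄} → mono τ₁ ⊑ mono τ₃ → mono τ₂ ⊑ mono τ₄ →
              mono (τ₁ ⊗ τ₂) ⊑ mono (τ₃ ⊗ τ₄)
      ⊑arr  : ∀ {σ₁ τ₁ σ₂ τ₂} → σ₂ ⊑ σ₁ → mono τ₁ ⊑ mono τ₂ →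
              mono (σ₁ ⇒ τ₁) ⊑ mono (σ₂ ⇒ τ₂)
      -- ∀ī.τ₁ ⊑ σ₂ : the bound ī of σ₁ are fresh for σ₂ (they are de Bruijn
      -- 0..k-1 and σ₂'s free variables are shifted past them), and
      -- σ₂ ⊒ τ₂ := (body σ₂){j̄ ↦ b̄} with τ₁ ⊑ τ₂.
      ⊑gen  : ∀ {σ₁ σ₂} (bs : Vec Term (binders σ₂)) →
              mono (body σ₁) ⊑ mono (instAt (binders σ₁) σ₂ bs) → σ₁ ⊑ σ₂

module Submission where

-- The rule ⊑gen of _⊑_ applies to every pair of types (a monotype is ∀ε.τ), so
-- derivations are not syntax directed.  We therefore introduce a
-- syntax-directed relation: _⊑ₘ_ on monotypes uses only the structural rules,
-- _⊑ₛ_ on types uses only the instantiation rule, and the two are mutually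
-- nested.  It is equivalent to _⊑_ (soundness/completeness), and all four
-- properties are proved for it by structural recursion:
--   * reflexivity instantiates the binders of a type by themselves;
--   * substitution closure pushes the substitution through instantiation;
--   * transitivity composes the two instantiations; since the middle type is
--     then a substitution instance, the recursion is on its size;
--   * monotonicity is proved for any pair of substitutions θ₁, θ₂ where θ₂
--     grows over θ₁ and shrinks only at one variable i, by simultaneous
--     recursion on positive and negative occurrences.

open import Defs
open import Data.Nat using (ℕ; zero; suc; _+_; _≤_; s≤s; z≤n)
open import Data.Nat.Properties
  using (≤-refl; ≤-trans; +-mono-≤; +-identityʳ; +-suc; m+n≤o⇒m≤o; m+n≤o⇒n≤o; _≟_)
open import Data.Product using (_×_; _,_)
open import Data.Sum using (inj₁; inj₂)
open import Data.Fin using (Fin)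
open import Data.Vec using (Vec; []; _∷_; lookup)
open import Data.Empty using (⊥-elim)
open import Function using (_∘_)
open import Relation.Nullary using (¬_; yes; no)
open import Relation.Binary.PropositionalEquality

module Properties (Sym : Set) (ar : Sym → ℕ) (nB : ℕ) (J : Sized.Interp Sym ar nB) where
  open Sized Sym ar nB
  open Sub J
  open Interp J

  _⊙_ : Subst → Subst → Subst
  θ₁ ⊙ θ₂ = sub θ₁ ∘ θ₂

  wk : ℕ → Subst
  wk k y = var (k + y)

  mutual
    sub-cong : ∀ {θ θ'} → θ ≗ θ' → ∀ a → sub θ a ≡ sub θ' a
    sub-cong e (var x) = e x
    sub-cong e 0ᵢ = refl
    sub-cong e (sᵢ a) = cong sᵢ (sub-cong e a)
    sub-cong e (a +ᵢ b) = cong₂ _+ᵢ_ (sub-cong e a) (sub-cong e b)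
    sub-cong e (app g as) = cong (app g) (subV-cong e as)

    subV-cong : ∀ {n θ θ'} → θ ≗ θ' → (as : Vec Term n) → subV θ as ≡ subV θ' as
    subV-cong e [] = refl
    subV-cong e (a ∷ as) = cong₂ _∷_ (sub-cong e a) (subV-cong e as)

  mutual
    sub-id : ∀ {θ} → θ ≗ var → ∀ a → sub θ a ≡ a
    sub-id e (var x) = e x
    sub-id e 0ᵢ = refl
    sub-id e (sᵢ a) = cong sᵢ (sub-id e a)
    sub-id e (a +ᵢ b) = cong₂ _+ᵢ_ (sub-id e a) (sub-id e b)
    sub-id e (app g as) = cong (app g) (subV-id e as)

    subV-id : ∀ {n θ} → θ ≗ var → (as : Vec Term n) → subV θ as ≡ as
    subV-id e [] = refl
    subV-id e (a ∷ as) = cong₂ _∷_ (sub-id e a) (subV-id e as)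

  mutual
    sub-⊙ : ∀ θ₁ θ₂ a → sub θ₁ (sub θ₂ a) ≡ sub (θ₁ ⊙ θ₂) a
    sub-⊙ θ₁ θ₂ (var x) = refl
    sub-⊙ θ₁ θ₂ 0ᵢ = refl
    sub-⊙ θ₁ θ₂ (sᵢ a) = cong sᵢ (sub-⊙ θ₁ θ₂ a)
    sub-⊙ θ₁ θ₂ (a +ᵢ b) = cong₂ _+ᵢ_ (sub-⊙ θ₁ θ₂ a) (sub-⊙ θ₁ θ₂ b)
    sub-⊙ θ₁ θ₂ (app g as) = cong (app g) (subV-⊙ θ₁ θ₂ as)

    subV-⊙ : ∀ {n} θ₁ θ₂ (as : Vec Term n) → subV θ₁ (subV θ₂ as) ≡ subV (θ₁ ⊙ θ₂) as
    subV-⊙ θ₁ θ₂ [] = refl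
    subV-⊙ θ₁ θ₂ (a ∷ as) = cong₂ _∷_ (sub-⊙ θ₁ θ₂ a) (subV-⊙ θ₁ θ₂ as)

  mutual
    ren-sub : ∀ r a → ren r a ≡ sub (var ∘ r) a
    ren-sub r (var x) = refl
    ren-sub r 0ᵢ = refl
    ren-sub r (sᵢ a) = cong sᵢ (ren-sub r a)
    ren-sub r (a +ᵢ b) = cong₂ _+ᵢ_ (ren-sub r a) (ren-sub r b)
    ren-sub r (app g as) = cong (app g) (renV-sub r as)

    renV-sub : ∀ {n} r (as : Vec Term n) → renV r as ≡ subV (var ∘ r) as
    renV-sub r [] = refl
    renV-sub r (a ∷ as) = cong₂ _∷_ (ren-sub r a) (renV-sub r as)

  lift-cong : ∀ {θ θ'} → θ ≗ θ' → lift θ ≗ lift θ'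
  lift-cong e zero = refl
  lift-cong e (suc x) = cong (ren suc) (e x)

  liftN-cong : ∀ n {θ θ'} → θ ≗ θ' → liftN n θ ≗ liftN n θ'
  liftN-cong zero e = e
  liftN-cong (suc n) e = lift-cong (liftN-cong n e)

  lift-id : ∀ {θ} → θ ≗ var → lift θ ≗ var
  lift-id e zero = refl
  lift-id e (suc x) = cong (ren suc) (e x)

  liftN-id : ∀ n {θ} → θ ≗ var → liftN n θ ≗ var
  liftN-id zero e = e
  liftN-id (suc n) e = lift-id (liftN-id n e)

  lift-⊙ : ∀ θ₁ θ₂ → lift (θ₁ ⊙ θ₂) ≗ lift θ₁ ⊙ lift θ₂
  lift-⊙ θ₁ θ₂ zero = refl
  lift-⊙ θ₁ θ₂ (suc x) = begin
      ren suc (sub θ₁ (θ₂ x))                ≡⟨ ren-sub suc _ ⟩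
      sub (wk 1) (sub θ₁ (θ₂ x))             ≡⟨ sub-⊙ (wk 1) θ₁ (θ₂ x) ⟩
      sub (wk 1 ⊙ θ₁) (θ₂ x)                 ≡⟨ sub-cong (λ y → sym (ren-sub suc (θ₁ y))) (θ₂ x) ⟩
      sub (lift θ₁ ⊙ wk 1) (θ₂ x)            ≡⟨ sym (sub-⊙ (lift θ₁) (wk 1) (θ₂ x)) ⟩
      sub (lift θ₁) (sub (wk 1) (θ₂ x))      ≡⟨ cong (sub (lift θ₁)) (sym (ren-sub suc (θ₂ x))) ⟩
      sub (lift θ₁) (ren suc (θ₂ x))         ∎
    where open ≡-Reasoning

  liftN-⊙ : ∀ n θ₁ θ₂ → liftN n (θ₁ ⊙ θ₂) ≗ liftN n θ₁ ⊙ liftN n θ₂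
  liftN-⊙ zero θ₁ θ₂ x = refl
  liftN-⊙ (suc n) θ₁ θ₂ x =
    trans (lift-cong (liftN-⊙ n θ₁ θ₂) x) (lift-⊙ (liftN n θ₁) (liftN n θ₂) x)

  liftN-wk : ∀ k θ x → liftN k θ (k + x) ≡ sub (wk k) (θ x)
  liftN-wk zero θ x = sym (sub-id (λ y → refl) (θ x))
  liftN-wk (suc k) θ x = begin
      ren suc (liftN k θ (k + x))            ≡⟨ cong (ren suc) (liftN-wk k θ x) ⟩
      ren suc (sub (wk k) (θ x))             ≡⟨ ren-sub suc _ ⟩
      sub (wk 1) (sub (wk k) (θ x))          ≡⟨ sub-⊙ (wk 1) (wk k) (θ x) ⟩
      sub (wk (suc k)) (θ x)                 ∎
    where open ≡-Reasoning

  mutual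
    subM-cong : ∀ {θ θ'} → θ ≗ θ' → ∀ τ → subM θ τ ≡ subM θ' τ
    subM-cong e (base β a) = cong (base β) (sub-cong e a)
    subM-cong e (τ₁ ⊗ τ₂) = cong₂ _⊗_ (subM-cong e τ₁) (subM-cong e τ₂)
    subM-cong e (σ ⇒ τ) = cong₂ _⇒_ (subT-cong e σ) (subM-cong e τ)

    subT-cong : ∀ {θ θ'} → θ ≗ θ' → ∀ σ → subT θ σ ≡ subT θ' σ
    subT-cong e (mono τ) = cong mono (subM-cong e τ)
    subT-cong e (poly n σ τ) =
      cong₂ (poly n) (subT-cong (liftN-cong (suc n) e) σ) (subM-cong (liftN-cong (suc n) e) τ)

  mutual
    subM-id : ∀ {θ} → θ ≗ var → ∀ τ → subM θ τ ≡ τ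
    subM-id e (base β a) = cong (base β) (sub-id e a)
    subM-id e (τ₁ ⊗ τ₂) = cong₂ _⊗_ (subM-id e τ₁) (subM-id e τ₂)
    subM-id e (σ ⇒ τ) = cong₂ _⇒_ (subT-id e σ) (subM-id e τ)

    subT-id : ∀ {θ} → θ ≗ var → ∀ σ → subT θ σ ≡ σ
    subT-id e (mono τ) = cong mono (subM-id e τ)
    subT-id e (poly n σ τ) =
      cong₂ (poly n) (subT-id (liftN-id (suc n) e) σ) (subM-id (liftN-id (suc n) e) τ)

  mutual
    subM-⊙ : ∀ θ₁ θ₂ τ → subM θ₁ (subM θ₂ τ) ≡ subM (θ₁ ⊙ θ₂) τ
    subM-⊙ θ₁ θ₂ (base β a) = cong (base β) (sub-⊙ θ₁ θ₂ a)
    subM-⊙ θ₁ θ₂ (τ₁ ⊗ τ₂) = cong₂ _⊗_ (subM-⊙ θ₁ θ₂ τ₁) (subM-⊙ θ₁ θ₂ τ₂)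
    subM-⊙ θ₁ θ₂ (σ ⇒ τ) = cong₂ _⇒_ (subT-⊙ θ₁ θ₂ σ) (subM-⊙ θ₁ θ₂ τ)

    subT-⊙ : ∀ θ₁ θ₂ σ → subT θ₁ (subT θ₂ σ) ≡ subT (θ₁ ⊙ θ₂) σ
    subT-⊙ θ₁ θ₂ (mono τ) = cong mono (subM-⊙ θ₁ θ₂ τ)
    subT-⊙ θ₁ θ₂ (poly n σ τ) = cong₂ (poly n)
      (trans (subT-⊙ (liftN (suc n) θ₁) (liftN (suc n) θ₂) σ)
             (subT-cong (λ x → sym (liftN-⊙ (suc n) θ₁ θ₂ x)) σ))
      (trans (subM-⊙ (liftN (suc n) θ₁) (liftN (suc n) θ₂) τ)
             (subM-cong (λ x → sym (liftN-⊙ (suc n) θ₁ θ₂ x)) τ))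

  -- Size of types: the measure for transitivity, invariant under substitution

  mutual
    sizeM : Mono → ℕ
    sizeM (base β a) = zero
    sizeM (τ₁ ⊗ τ₂) = suc (sizeM τ₁ + sizeM τ₂)
    sizeM (σ ⇒ τ) = suc (sizeT σ + sizeM τ)

    sizeT : Ty → ℕ
    sizeT (mono τ) = suc (sizeM τ)
    sizeT (poly n σ τ) = suc (suc (sizeT σ + sizeM τ))

  sizeT-body : ∀ σ → sizeT σ ≡ suc (sizeM (body σ))
  sizeT-body (mono τ) = refl
  sizeT-body (poly n σ τ) = refl

  mutual
    sizeM-sub : ∀ θ τ → sizeM (subM θ τ) ≡ sizeM τ
    sizeM-sub θ (base β a) = refl
    sizeM-sub θ (τ₁ ⊗ τ₂) = cong suc (cong₂ _+_ (sizeM-sub θ τ₁) (sizeM-sub θ τ₂))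
    sizeM-sub θ (σ ⇒ τ) = cong suc (cong₂ _+_ (sizeT-sub θ σ) (sizeM-sub θ τ))

    sizeT-sub : ∀ θ σ → sizeT (subT θ σ) ≡ sizeT σ
    sizeT-sub θ (mono τ) = cong suc (sizeM-sub θ τ)
    sizeT-sub θ (poly n σ τ) =
      cong (suc ∘ suc) (cong₂ _+_ (sizeT-sub _ σ) (sizeM-sub _ τ))

  mutual
    ⟦sub⟧ : ∀ θ a ρ → ⟦ sub θ a ⟧ ρ ≡ ⟦ a ⟧ (λ x → ⟦ θ x ⟧ ρ)
    ⟦sub⟧ θ (var x) ρ = refl
    ⟦sub⟧ θ 0ᵢ ρ = refl
    ⟦sub⟧ θ (sᵢ a) ρ = cong suc (⟦sub⟧ θ a ρ)
    ⟦sub⟧ θ (a +ᵢ b) ρ = cong₂ _+_ (⟦sub⟧ θ a ρ) (⟦sub⟧ θ b ρ)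
    ⟦sub⟧ θ (app g as) ρ = cong ⟦ g ⟧ˢ (⟦subV⟧ θ as ρ)

    ⟦subV⟧ : ∀ {n} θ (as : Vec Term n) ρ → ⟦ subV θ as ⟧V ρ ≡ ⟦ as ⟧V (λ x → ⟦ θ x ⟧ ρ)
    ⟦subV⟧ θ [] ρ = refl
    ⟦subV⟧ θ (a ∷ as) ρ = cong₂ _∷_ (⟦sub⟧ θ a ρ) (⟦subV⟧ θ as ρ)

  mutual
    ⟦⟧-mono : ∀ a {ρ ρ'} → (∀ x → x ∈V a → ρ x ≤ ρ' x) → ⟦ a ⟧ ρ ≤ ⟦ a ⟧ ρ'
    ⟦⟧-mono (var x) h = h x here
    ⟦⟧-mono 0ᵢ h = z≤n
    ⟦⟧-mono (sᵢ a) h = s≤s (⟦⟧-mono a (λ x → h x ∘ ins))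
    ⟦⟧-mono (a +ᵢ b) h = +-mono-≤ (⟦⟧-mono a (λ x → h x ∘ in+ˡ)) (⟦⟧-mono b (λ x → h x ∘ in+ʳ))
    ⟦⟧-mono (app g as) {ρ} {ρ'} h =
      monotone g (⟦ as ⟧V ρ) (⟦ as ⟧V ρ') (⟦⟧V-mono as (λ x k → h x ∘ inapp k))

    ⟦⟧V-mono : ∀ {n} (as : Vec Term n) {ρ ρ'} → (∀ x k → x ∈V lookup as k → ρ x ≤ ρ' x) →
               ∀ k → lookup (⟦ as ⟧V ρ) k ≤ lookup (⟦ as ⟧V ρ') k
    ⟦⟧V-mono (a ∷ as) h Fin.zero = ⟦⟧-mono a (λ x → h x Fin.zero)
    ⟦⟧V-mono (a ∷ as) h (Fin.suc k) = ⟦⟧V-mono as (λ x k' → h x (Fin.suc k')) k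

  ≤J-refl : ∀ a → a ≤J a
  ≤J-refl a ρ = ≤-refl

  ≤J-sub : ∀ θ {a b} → a ≤J b → sub θ a ≤J sub θ b
  ≤J-sub θ {a} {b} h ρ = subst₂ _≤_ (sym (⟦sub⟧ θ a ρ)) (sym (⟦sub⟧ θ b ρ)) (h _)

  ≤J-ren : ∀ r {a b} → a ≤J b → ren r a ≤J ren r b
  ≤J-ren r {a} {b} h =
    subst₂ _≤J_ (sym (ren-sub r a)) (sym (ren-sub r b)) (≤J-sub (var ∘ r) {a} {b} h)

  sub-≤J : ∀ {θ₁ θ₂} a → (∀ x → x ∈V a → θ₁ x ≤J θ₂ x) → sub θ₁ a ≤J sub θ₂ a
  sub-≤J {θ₁} {θ₂} a h ρ =
    subst₂ _≤_ (sym (⟦sub⟧ θ₁ a ρ)) (sym (⟦sub⟧ θ₂ a ρ)) (⟦⟧-mono a (λ x p → h x p ρ))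

  mutual
    data _⊑ₘ_ : Mono → Mono → Set where
      ⊑ₘ-base : ∀ {β a b} → a ≤J b → base β a ⊑ₘ base β b
      ⊑ₘ-prod : ∀ {τ₁ τ₂ τ₃ τ₄} → τ₁ ⊑ₘ τ₃ → τ₂ ⊑ₘ τ₄ → (τ₁ ⊗ τ₂) ⊑ₘ (τ₃ ⊗ τ₄)
      ⊑ₘ-arr  : ∀ {σ₁ τ₁ σ₂ τ₂} → σ₂ ⊑ₛ σ₁ → τ₁ ⊑ₘ τ₂ → (σ₁ ⇒ τ₁) ⊑ₘ (σ₂ ⇒ τ₂)

    data _⊑ₛ_ : Ty → Ty → Set where
      ⊑ₛ-inst : ∀ {σ₁ σ₂} (bs : Vec Term (binders σ₂)) →
                body σ₁ ⊑ₘ instAt (binders σ₁) σ₂ bs → σ₁ ⊑ₛ σ₂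

  mutual
    soundₘ : ∀ {τ₁ τ₂} → τ₁ ⊑ₘ τ₂ → mono τ₁ ⊑ mono τ₂
    soundₘ (⊑ₘ-base h) = ⊑base h
    soundₘ (⊑ₘ-prod p q) = ⊑prod (soundₘ p) (soundₘ q)
    soundₘ (⊑ₘ-arr p q) = ⊑arr (sound p) (soundₘ q)

    sound : ∀ {σ₁ σ₂} → σ₁ ⊑ₛ σ₂ → σ₁ ⊑ σ₂
    sound (⊑ₛ-inst bs p) = ⊑gen bs (soundₘ p)

  instAt-mono : ∀ τ → instAt 0 (mono τ) [] ≡ τ
  instAt-mono = subM-id (λ _ → refl)

  -- ... and conversely: a use of ⊑gen between monotypes instantiates nothing,
  -- and a structural rule between types is preceded by a trivial instantiation.
  mutual
    completeₘ : ∀ {τ₁ τ₂} → mono τ₁ ⊑ mono τ₂ → τ₁ ⊑ₘ τ₂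
    completeₘ (⊑base h) = ⊑ₘ-base h
    completeₘ (⊑prod p q) = ⊑ₘ-prod (completeₘ p) (completeₘ q)
    completeₘ (⊑arr p q) = ⊑ₘ-arr (complete p) (completeₘ q)
    completeₘ {τ₁} {τ₂} (⊑gen [] p) = subst (τ₁ ⊑ₘ_) (instAt-mono τ₂) (completeₘ p)

    complete : ∀ {σ₁ σ₂} → σ₁ ⊑ σ₂ → σ₁ ⊑ₛ σ₂
    complete (⊑gen bs p) = ⊑ₛ-inst bs (completeₘ p)
    complete {mono τ₁} {mono τ₂} p =
      ⊑ₛ-inst [] (subst (τ₁ ⊑ₘ_) (sym (instAt-mono τ₂)) (completeₘ p))

  vars : ℕ → (m : ℕ) → Vec Term m
  vars j zero = []
  vars j (suc m) = var j ∷ vars (suc j) m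

  instSub-vars : ∀ m j (rest : Subst) → (∀ y → rest y ≡ var (j + (m + y))) →
                 instSub (vars j m) rest ≗ wk j
  instSub-vars zero j rest e x = e x
  instSub-vars (suc m) j rest e zero = cong var (sym (+-identityʳ j))
  instSub-vars (suc m) j rest e (suc x) =
    trans (instSub-vars m (suc j) rest (λ y → trans (e y) (cong var (+-suc j (m + y)))) x)
          (cong var (sym (+-suc j x)))

  instAt-vars : ∀ σ → instAt (binders σ) σ (vars 0 (binders σ)) ≡ body σ
  instAt-vars σ = subM-id (instSub-vars (binders σ) 0 (wk (binders σ)) (λ _ → refl)) (body σ)

  below-self-instance : ∀ {τ} σ → τ ⊑ₘ body σ →
                        τ ⊑ₘ instAt (binders σ) σ (vars 0 (binders σ))
  below-self-instance {τ} σ = subst (τ ⊑ₘ_) (sym (instAt-vars σ))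

  instSub-skip : ∀ {m} (bs : Vec Term m) rest x → instSub bs rest (m + x) ≡ rest x
  instSub-skip [] rest x = refl
  instSub-skip (b ∷ bs) rest x = instSub-skip bs rest x

  instSub-⊙ : ∀ k θ {m} (bs : Vec Term m) →
    liftN k θ ⊙ instSub bs (wk k) ≗ instSub (subV (liftN k θ) bs) (wk k) ⊙ liftN m θ
  instSub-⊙ k θ [] x = liftN-wk k θ x
  instSub-⊙ k θ (b ∷ bs) zero = refl
  instSub-⊙ k θ {suc m} (b ∷ bs) (suc x) = begin
      sub (liftN k θ) (instSub bs (wk k) x)                    ≡⟨ instSub-⊙ k θ bs x ⟩
      sub (instSub (subV (liftN k θ) bs) (wk k)) (liftN m θ x) ≡⟨ sym (sub-⊙ ψ (wk 1) (liftN m θ x)) ⟩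
      sub ψ (sub (wk 1) (liftN m θ x))                         ≡⟨ cong (sub ψ) (sym (ren-sub suc (liftN m θ x))) ⟩
      sub ψ (ren suc (liftN m θ x))                            ∎
    where
      open ≡-Reasoning
      ψ = instSub (subV (liftN k θ) (b ∷ bs)) (wk k)

  instAt-sub : ∀ k θ σ (bs : Vec Term (binders σ)) →
    subM (liftN k θ) (instAt k σ bs)
      ≡ subM (instSub (subV (liftN k θ) bs) (wk k)) (subM (liftN (binders σ) θ) (body σ))
  instAt-sub k θ σ bs =
    trans (subM-⊙ _ _ (body σ))
    (trans (subM-cong (instSub-⊙ k θ bs) (body σ)) (sym (subM-⊙ _ _ (body σ))))

  instSub-instSub : ∀ k₁ {k₂} (bs : Vec Term k₂) {m} (cs : Vec Term m) →
    instSub bs (wk k₁) ⊙ instSub cs (wk k₂) ≗ instSub (subV (instSub bs (wk k₁)) cs) (wk k₁)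
  instSub-instSub k₁ bs [] x = instSub-skip bs _ x
  instSub-instSub k₁ bs (c ∷ cs) zero = refl
  instSub-instSub k₁ bs (c ∷ cs) (suc x) = instSub-instSub k₁ bs cs x

  -- Reflexivity: instantiate every binder by itself.
  mutual
    reflₘ : ∀ τ → τ ⊑ₘ τ
    reflₘ (base β a) = ⊑ₘ-base (≤J-refl a)
    reflₘ (τ₁ ⊗ τ₂) = ⊑ₘ-prod (reflₘ τ₁) (reflₘ τ₂)
    reflₘ (σ ⇒ τ) = ⊑ₘ-arr (reflₛ σ) (reflₘ τ)

    reflₛ : ∀ σ → σ ⊑ₛ σ
    reflₛ (mono τ) = ⊑ₛ-inst [] (below-self-instance (mono τ) (reflₘ τ))
    reflₛ (poly n σ τ) =
      ⊑ₛ-inst (vars 0 (suc n)) (below-self-instance (poly n σ τ) (⊑ₘ-arr (reflₛ σ) (reflₘ τ)))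

  -- The binders and body of subT θ σ compute once the head of σ is known, which
  -- is what is needed to rebuild an instantiation step for substituted types.
  inst-subT : ∀ θ σ₁ σ₂ (bs : Vec Term (binders σ₂)) →
    let θ₁ = liftN (binders σ₁) θ in
    subM θ₁ (body σ₁) ⊑ₘ subM (instSub (subV θ₁ bs) (wk (binders σ₁))) (subM (liftN (binders σ₂) θ) (body σ₂)) →
    subT θ σ₁ ⊑ₛ subT θ σ₂
  inst-subT θ σ₁@(mono _)     (mono _)     bs = ⊑ₛ-inst (subV (liftN (binders σ₁) θ) bs)
  inst-subT θ σ₁@(mono _)     (poly _ _ _) bs = ⊑ₛ-inst (subV (liftN (binders σ₁) θ) bs)
  inst-subT θ σ₁@(poly _ _ _) (mono _)     bs = ⊑ₛ-inst (subV (liftN (binders σ₁) θ) bs)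
  inst-subT θ σ₁@(poly _ _ _) (poly _ _ _) bs = ⊑ₛ-inst (subV (liftN (binders σ₁) θ) bs)

  -- Closure under substitution: an instantiation step is substituted under
  -- σ₁'s binders, and instAt-sub turns the result into an instantiation step.
  mutual
    substₘ : ∀ θ {τ₁ τ₂} → τ₁ ⊑ₘ τ₂ → subM θ τ₁ ⊑ₘ subM θ τ₂
    substₘ θ (⊑ₘ-base {a = a} {b} h) = ⊑ₘ-base (≤J-sub θ {a} {b} h)
    substₘ θ (⊑ₘ-prod p q) = ⊑ₘ-prod (substₘ θ p) (substₘ θ q)
    substₘ θ (⊑ₘ-arr p q) = ⊑ₘ-arr (substₛ θ p) (substₘ θ q)

    substₛ : ∀ θ {σ₁ σ₂} → σ₁ ⊑ₛ σ₂ → subT θ σ₁ ⊑ₛ subT θ σ₂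
    substₛ θ (⊑ₛ-inst {σ₁} {σ₂} bs p) =
      inst-subT θ σ₁ σ₂ bs (subst (_ ⊑ₘ_) (instAt-sub (binders σ₁) θ σ₂ bs)
                                          (substₘ (liftN (binders σ₁) θ) p))

  -- Transitivity, by recursion on (a bound n on) the size of the middle type.
  mutual
    transₘ : ∀ {n τ₁ τ₂ τ₃} → τ₁ ⊑ₘ τ₂ → τ₂ ⊑ₘ τ₃ → sizeM τ₂ ≤ n → τ₁ ⊑ₘ τ₃
    transₘ (⊑ₘ-base p) (⊑ₘ-base q) _ = ⊑ₘ-base (λ ρ → ≤-trans (p ρ) (q ρ))
    transₘ (⊑ₘ-prod p₁ p₂) (⊑ₘ-prod q₁ q₂) (s≤s h) =
      ⊑ₘ-prod (transₘ p₁ q₁ (m+n≤o⇒m≤o _ h)) (transₘ p₂ q₂ (m+n≤o⇒n≤o _ h))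
    transₘ {τ₂ = σ ⇒ τ} (⊑ₘ-arr p₁ p₂) (⊑ₘ-arr q₁ q₂) (s≤s h) =
      ⊑ₘ-arr (transₛ q₁ p₁ (subst (_≤ _) (sizeT-body σ) (m+n≤o⇒m≤o _ h)))
             (transₘ p₂ q₂ (m+n≤o⇒n≤o _ h))

    -- σ₁ ⊑ₛ σ₂ ⊑ₛ σ₃: instantiate σ₂'s instance of σ₃ further by the
    -- instantiation bs of σ₂, then compose on the bodies.
    transₛ : ∀ {n σ₁ σ₂ σ₃} → σ₁ ⊑ₛ σ₂ → σ₂ ⊑ₛ σ₃ → suc (sizeM (body σ₂)) ≤ n → σ₁ ⊑ₛ σ₃
    transₛ {σ₁ = σ₁} {σ₂} {σ₃} (⊑ₛ-inst bs p) (⊑ₛ-inst cs q) (s≤s h) =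
      ⊑ₛ-inst (subV θ cs) (transₘ p q' (subst (_≤ _) (sym (sizeM-sub θ (body σ₂))) h))
      where
        θ = instSub bs (wk (binders σ₁))
        q' : instAt (binders σ₁) σ₂ bs ⊑ₘ instAt (binders σ₁) σ₃ (subV θ cs)
        q' = subst (_ ⊑ₘ_) (trans (subM-⊙ _ _ (body σ₃))
                                  (subM-cong (instSub-instSub (binders σ₁) bs cs) (body σ₃)))
                   (substₘ θ q)

  record GrowsAt (i : ℕ) (θ₁ θ₂ : Subst) : Set where
    field
      up   : ∀ x → θ₁ x ≤J θ₂ x
      down : ∀ x → ¬ x ≡ i → θ₂ x ≤J θ₁ x
  open GrowsAt

  lift-grows : ∀ {i θ₁ θ₂} → GrowsAt i θ₁ θ₂ → GrowsAt (suc i) (lift θ₁) (lift θ₂)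
  up   (lift-grows g) zero = ≤J-refl (var zero)
  up   (lift-grows {θ₁ = θ₁} {θ₂} g) (suc x) = ≤J-ren suc {θ₁ x} {θ₂ x} (up g x)
  down (lift-grows g) zero _ = ≤J-refl (var zero)
  down (lift-grows {θ₁ = θ₁} {θ₂} g) (suc x) x≢ =
    ≤J-ren suc {θ₂ x} {θ₁ x} (down g x (x≢ ∘ cong suc))

  liftN-grows : ∀ k {i θ₁ θ₂} → GrowsAt i θ₁ θ₂ → GrowsAt (k + i) (liftN k θ₁) (liftN k θ₂)
  liftN-grows zero g = g
  liftN-grows (suc k) g = lift-grows (liftN-grows k g)

  pt-grows : ∀ i {a b} → a ≤J b → GrowsAt i (pt i a) (pt i b)
  up (pt-grows i ab) x with x ≟ i
  ... | yes _ = ab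
  ... | no  _ = ≤J-refl (var x)
  down (pt-grows i ab) x x≢i with x ≟ i
  ... | yes x≡i = ⊥-elim (x≢i x≡i)
  ... | no  _   = ≤J-refl (var x)

  mutual
    growₘ : ∀ {θ₁ θ₂} i → GrowsAt i θ₁ θ₂ → ∀ τ → ¬ FNVm i τ → subM θ₁ τ ⊑ₘ subM θ₂ τ
    growₘ i g (base β a) _ = ⊑ₘ-base (sub-≤J a (λ x _ → up g x))
    growₘ i g (τ₁ ⊗ τ₂) n = ⊑ₘ-prod (growₘ i g τ₁ (n ∘ inj₁)) (growₘ i g τ₂ (n ∘ inj₂))
    growₘ i g (σ ⇒ τ) n = ⊑ₘ-arr (shrinkₛ i g σ (n ∘ inj₁)) (growₘ i g τ (n ∘ inj₂))

    shrinkₘ : ∀ {θ₁ θ₂} i → GrowsAt i θ₁ θ₂ → ∀ τ → ¬ FPVm i τ → subM θ₂ τ ⊑ₘ subM θ₁ τ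
    shrinkₘ i g (base β a) n =
      ⊑ₘ-base (sub-≤J a (λ x p → down g x (λ x≡i → n (subst (_∈V a) x≡i p))))
    shrinkₘ i g (τ₁ ⊗ τ₂) n = ⊑ₘ-prod (shrinkₘ i g τ₁ (n ∘ inj₁)) (shrinkₘ i g τ₂ (n ∘ inj₂))
    shrinkₘ i g (σ ⇒ τ) n = ⊑ₘ-arr (growₛ i g σ (n ∘ inj₁)) (shrinkₘ i g τ (n ∘ inj₂))

    growₛ : ∀ {θ₁ θ₂} i → GrowsAt i θ₁ θ₂ → ∀ σ → ¬ FNVt i σ → subT θ₁ σ ⊑ₛ subT θ₂ σ
    growₛ {θ₂ = θ₂} i g (mono τ) n =
      ⊑ₛ-inst [] (below-self-instance (subT θ₂ (mono τ)) (growₘ i g τ n))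
    growₛ {θ₂ = θ₂} i g (poly k σ τ) n =
      ⊑ₛ-inst (vars 0 (suc k)) (below-self-instance (subT θ₂ (poly k σ τ))
        (⊑ₘ-arr (shrinkₛ (suc k + i) g' σ (n ∘ inj₁)) (growₘ (suc k + i) g' τ (n ∘ inj₂))))
      where g' = liftN-grows (suc k) g

    shrinkₛ : ∀ {θ₁ θ₂} i → GrowsAt i θ₁ θ₂ → ∀ σ → ¬ FPVt i σ → subT θ₂ σ ⊑ₛ subT θ₁ σ
    shrinkₛ {θ₁ = θ₁} i g (mono τ) n =
      ⊑ₛ-inst [] (below-self-instance (subT θ₁ (mono τ)) (shrinkₘ i g τ n))
    shrinkₛ {θ₁ = θ₁} i g (poly k σ τ) n =
      ⊑ₛ-inst (vars 0 (suc k)) (below-self-instance (subT θ₁ (poly k σ τ))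
        (⊑ₘ-arr (growₛ (suc k + i) g' σ (n ∘ inj₁)) (shrinkₘ (suc k + i) g' τ (n ∘ inj₂))))
      where g' = liftN-grows (suc k) g

lemma5p2 : (Sym : Set) (ar : Sym → ℕ) (nB : ℕ) (J : Sized.Interp Sym ar nB) →
    let open Sized Sym ar nB in let open Sub J in
    (∀ σ → σ ⊑ σ)
    × (∀ σ₁ σ₂ σ₃ → σ₁ ⊑ σ₂ → σ₂ ⊑ σ₃ → σ₁ ⊑ σ₃)
    × (∀ σ₁ σ₂ (θ : Subst) → σ₁ ⊑ σ₂ → subT θ σ₁ ⊑ subT θ σ₂)
    × (∀ a b → a ≤J b → ∀ (σ : Ty) (i : ℕ) → ¬ FNVt i σ → subT (pt i a) σ ⊑ subT (pt i b) σ)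
lemma5p2 Sym ar nB J =
    (λ σ → sound (reflₛ σ))
  , (λ σ₁ σ₂ σ₃ p q → sound (transₛ (complete p) (complete q) ≤-refl))
  , (λ σ₁ σ₂ θ p → sound (substₛ θ (complete p)))
  , (λ a b a≤b σ i n → sound (growₛ i (pt-grows i a≤b) σ n))
  where open Properties Sym ar nB J
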